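{- Suppose $\mathcal{U}$ and $\mathcal{U}_n$ ($n<\omega$) are ultrafilters on $\omega$, each basically generated by a filter base which is closed under finite intersections. Then $\mathcal{V}=\lim_{n\to\mathcal{U}}\mathcal{U}_n$ is basically generated by a filter base which is closed under finite intersections. Consequently, the class of ultrafilters basically generated by some filter base closed under finite intersections is closed under Fubini products.
   Context: An ultrafilter $\mathcal{W}$ on a countable set $S$ is basically generated if it has a filter base $\mathcal{B}\subseteq\mathcal{W}$ (for every $A\in\mathcal{W}$ there is $B\in\mathcal{B}$ with $B\subseteq A$) such that every sequence $(A_n)_{n<\omega}\subseteq\mathcal{B}$ converging (in the Cantor topology on $\mathcal{P}(S)$, i.e. pointwise convergence of characteristic functions) to an element of $\mathcal{B}$ has a subsequence $(A_{n_k})_{k<\omega}$ with $\bigcap_k A_{n_k}\in\mathcal{W}$. For ultrafilters $\mathcal{U},\mathcal{U}_n$ on $\omega$, $\lim_{n\to\mathcal{U}}\mathcal{U}_n$ is the ultrafilter on $\omega\times\omega$ consisting of all $A\subseteq\omega\times\omega$ such that $\{n:\{j:(n,j)\in A\}\in\mathcal{U}_n\}\in\mathcal{U}$; the Fubini product $\mathcal{U}\cdot\mathcal{V}$ is $\lim_{n\to\mathcal{U}}\mathcal{V}$. (Ultrafilters on $\omega\times\omega$ are identified with ultrafilters on $\omega$ via a bijection.) -}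

module Defs where

open import Data.Bool using (Bool; true; false; not; _∧_)
open import Data.Nat using (ℕ; suc; _≤_; _<_)
open import Data.Product using (Σ; ∃; ∃-syntax; _×_; _,_)
open import Data.Sum using (_⊎_)
open import Relation.Binary.PropositionalEquality using (_≡_)

-- A subset of S, identified with its characteristic function S → 2
-- (so that the Cantor topology on P(S) = 2^S is pointwise convergence).
Subset : Set → Set
Subset S = S → Bool

_∩_ : {S : Set} → Subset S → Subset S → Subset S
(A ∩ B) s = A s ∧ B s

ᶜ_ : {S : Set} → Subset S → Subset S
(ᶜ A) s = not (A s)

_⊆_ : {S : Set} → Subset S → Subset S → Set
A ⊆ B = ∀ s → A s ≡ true → B s ≡ true

∅ : {S : Set} → Subset S
∅ _ = false

Family : Set → Set
Family S = Subset S → Bool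

record IsUltrafilter {S : Set} (W : Family S) : Set where
  field
    empty∉  : W ∅ ≡ false
    upward  : ∀ A B → A ⊆ B → W A ≡ true → W B ≡ true
    inter   : ∀ A B → W A ≡ true → W B ≡ true → W (A ∩ B) ≡ true
    ultra   : ∀ A → (W A ≡ true) ⊎ (W (ᶜ A) ≡ true)

-- Convergence of a sequence of subsets in the Cantor topology on P(S):
-- pointwise eventual agreement of characteristic functions.
Converges : {S : Set} → (ℕ → Subset S) → Subset S → Set
Converges A L = ∀ s → ∃[ N ] (∀ n → N ≤ n → A n s ≡ L s)

StrictlyIncreasing : (ℕ → ℕ) → Set
StrictlyIncreasing φ = ∀ k → φ k < φ (suc k)

IsFilterBase : {S : Set} → Family S → (Subset S → Set) → Set
IsFilterBase W B =
  (∀ A → B A → W A ≡ true) ×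
  (∀ A → W A ≡ true → ∃[ C ] (B C × C ⊆ A))

ClosedUnderFiniteIntersections : {S : Set} → (Subset S → Set) → Set
ClosedUnderFiniteIntersections B = ∀ A C → B A → B C → B (A ∩ C)

-- "⋂ₖ A (φ k) ∈ W" is rendered as: some member of W is contained in
-- every A (φ k) (equivalent, as W is upward closed).
IntersectionInW : {S : Set} → Family S → (ℕ → Subset S) → Set
IntersectionInW W A = ∃[ C ] (W C ≡ true × (∀ k → C ⊆ A k))

BasicallyGeneratedBy : {S : Set} → Family S → (Subset S → Set) → Set
BasicallyGeneratedBy {S} W B =
  IsFilterBase W B ×
  (∀ (A : ℕ → Subset S) (L : Subset S) →
     (∀ n → B (A n)) → B L → Converges A L →
     ∃[ φ ] (StrictlyIncreasing φ × IntersectionInW W (λ k → A (φ k))))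

BasicallyGeneratedFI : {S : Set} → Family S → Set₁
BasicallyGeneratedFI {S} W =
  Σ (Subset S → Set) λ B → ClosedUnderFiniteIntersections B × BasicallyGeneratedBy W B

limU : Family ℕ → (ℕ → Family ℕ) → Family (ℕ × ℕ)
limU U Us A = U (λ n → Us n (λ j → A (n , j)))

_·_ : Family ℕ → Family ℕ → Family (ℕ × ℕ)
U · V = limU U (λ _ → V)

module Submission where

-- The base of V is
-- the family of "rectangles" X ⊗ Y = {(n , j) | n ∈ X, j ∈ Yₙ} with X ∈ B and
-- Yₙ ∈ Bₙ for all n; it is closed under intersections and generates V.
-- Given rectangles Xₘ ⊗ Yₘ converging to a rectangle X ⊗ Y:
--   * the sets Xₘ ∩ X converge to X, so (U basic) along a subsequence φ₀
--     some C₀ ∈ U lies below all of them;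
--   * for n ∈ X the rows Yₘ(n) converge to Y(n); a diagonal argument over n
--     (each stage refining the previous subsequence using that Uₙ is basic)
--     yields one subsequence δ of φ₀ and sets Cₙ ∈ Uₙ with Cₙ ⊆ Y_{δ k}(n)
--     for all k ≥ n;
--   * then E = C₀ ⊗ (Cₙ ∩ ⋂_{k<n} Y_{δ k}(n)) belongs to V and lies below
--     every X_{δ k} ⊗ Y_{δ k}.
-- Excluded middle is used only to pick an element of a member of Uₙ.

open import Defs
open import Level using (0ℓ)
open import Axiom.ExcludedMiddle using (ExcludedMiddle)
open import Algebra.Bundles using (CommutativeMonoid)
open import Data.Bool using (true; false; not; _∧_)
open import Data.Bool.Properties
  using (∧-conicalˡ; ∧-conicalʳ; ∧-identityʳ; ∧-zeroʳ; ∧-commutativeMonoid)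
open import Data.Nat using (ℕ; zero; suc; _≤_; _<_; _⊔_; z≤n; s≤s)
open import Data.Nat.Properties
  using (≤-trans; <-trans; <-≤-trans; n<1+n; m≤n⇒m<n∨m≡n; <-≤-connex; m≤m⊔n; m≤n⊔m)
open import Data.Product using (_×_; Σ; ∃-syntax; _,_; proj₁; proj₂)
open import Data.Sum using (_⊎_; inj₁; inj₂)
open import Data.Empty using (⊥; ⊥-elim)
open import Function using (_∘_; id)
open import Relation.Nullary using (yes; no)
open import Relation.Binary.PropositionalEquality using (_≡_; refl; sym; trans; cong; cong₂; subst; module ≡-Reasoning)
open import Algebra.Properties.CommutativeSemigroup
  (CommutativeMonoid.commutativeSemigroup ∧-commutativeMonoid) using (interchange)

∧-intro : ∀ {a b} → a ≡ true → b ≡ true → a ∧ b ≡ true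
∧-intro refl refl = refl

true∧ : ∀ {a} b → a ≡ true → a ∧ b ≡ b
true∧ b refl = refl

full : {S : Set} → Subset S
full _ = true

⋂< : {S : Set} → (ℕ → Subset S) → ℕ → Subset S
⋂< F zero = full
⋂< F (suc m) = ⋂< F m ∩ F m

⋂<-⊆ : {S : Set} (F : ℕ → Subset S) → ∀ {k m} → k < m → ⋂< F m ⊆ F k
⋂<-⊆ F {k} {suc m} (s≤s k≤m) s h with m≤n⇒m<n∨m≡n k≤m
... | inj₁ k<m = ⋂<-⊆ F k<m s (∧-conicalˡ _ _ h)
... | inj₂ refl = ∧-conicalʳ _ _ h

Eventually : (ℕ → Set) → Set
Eventually P = ∃[ N ] (∀ m → N ≤ m → P m)

eventually-× : ∀ {P Q : ℕ → Set} → Eventually P → Eventually Q → Eventually (λ m → P m × Q m)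
eventually-× (N , p) (M , q) =
  N ⊔ M , λ m le → p m (≤-trans (m≤m⊔n N M) le) , q m (≤-trans (m≤n⊔m N M) le)

strictly-monotone : ∀ {ψ} → StrictlyIncreasing ψ → ∀ {k l} → k < l → ψ k < ψ l
strictly-monotone h {k} {suc l} (s≤s k≤l) with m≤n⇒m<n∨m≡n k≤l
... | inj₁ k<l = <-trans (strictly-monotone h k<l) (h l)
... | inj₂ refl = h k

inflationary : ∀ {ψ} → StrictlyIncreasing ψ → ∀ k → k ≤ ψ k
inflationary h zero = z≤n
inflationary h (suc k) = <-≤-trans (s≤s (inflationary h k)) (h k)

∘-strictlyIncreasing : ∀ {ψ ρ} → StrictlyIncreasing ψ → StrictlyIncreasing ρ →
                       StrictlyIncreasing (ψ ∘ ρ)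
∘-strictlyIncreasing h g k = strictly-monotone h (g k)

converges-subsequence : ∀ {S : Set} {A : ℕ → Subset S} {L} {ψ} →
                        StrictlyIncreasing ψ → Converges A L → Converges (A ∘ ψ) L
converges-subsequence h c s =
  let (N , p) = c s in N , λ m N≤m → p _ (≤-trans N≤m (inflationary h m))

_occursIn_ : ℕ → (ℕ → ℕ) → Set
m occursIn τ = ∃[ j ] (m ≡ τ j)

-- Starting from
-- ψ₀ and refining at coordinates 0, 1, 2, … gives stages ψ n; the diagonal
-- δ k = ψ (1 + k) k is a subsequence of ψ₀ all of whose terms from index n
-- on are terms of the stage ψ (1 + n), which has property Q n.
module Diagonalisation
  (Q : ℕ → (ℕ → ℕ) → Set)
  (refine : ∀ n ψ → StrictlyIncreasing ψ → ∃[ ρ ] (StrictlyIncreasing ρ × Q n (ψ ∘ ρ)))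
  (ψ₀ : ℕ → ℕ) (ψ₀-increasing : StrictlyIncreasing ψ₀)
  where

  next : ℕ → Σ (ℕ → ℕ) StrictlyIncreasing → Σ (ℕ → ℕ) StrictlyIncreasing
  next n (ψ , h) = let (ρ , g , _) = refine n ψ h in ψ ∘ ρ , ∘-strictlyIncreasing h g

  stage : ℕ → Σ (ℕ → ℕ) StrictlyIncreasing
  stage zero = ψ₀ , ψ₀-increasing
  stage (suc n) = next n (stage n)

  ψ : ℕ → ℕ → ℕ
  ψ n = proj₁ (stage n)

  ρ : ℕ → ℕ → ℕ
  ρ n = proj₁ (refine n (ψ n) (proj₂ (stage n)))

  stage-has-Q : ∀ n → Q n (ψ (suc n))
  stage-has-Q n = proj₂ (proj₂ (refine n (ψ n) (proj₂ (stage n))))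

  stage-occurs : ∀ {n m} → n ≤ m → ∀ i → ψ m i occursIn ψ n
  stage-occurs {m = zero} z≤n i = i , refl
  stage-occurs {m = suc m} n≤1+m i with m≤n⇒m<n∨m≡n n≤1+m
  ... | inj₁ (s≤s n≤m) = stage-occurs n≤m (ρ m i)
  ... | inj₂ refl = i , refl

  δ : ℕ → ℕ
  δ k = ψ (suc k) k

  -- δ (1 + k) = ψ (1 + k) (ρ (1 + k) (1 + k)) and 1 + k ≤ ρ (1 + k) (1 + k).
  δ-increasing : StrictlyIncreasing δ
  δ-increasing k =
    strictly-monotone (proj₂ (stage (suc k)))
      (inflationary (proj₁ (proj₂ (refine (suc k) (ψ (suc k)) (proj₂ (stage (suc k)))))) (suc k))

  δ-occurs : ∀ {n k} → n ≤ suc k → δ k occursIn ψ n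
  δ-occurs n≤1+k = stage-occurs n≤1+k _

module UltrafilterFacts {S : Set} {W : Family S} (u : IsUltrafilter W) where
  open IsUltrafilter u

  member-⊈∅ : ∀ {A} → W A ≡ true → A ⊆ ∅ → ⊥
  member-⊈∅ {A} A∈ A⊆∅ with trans (sym (upward A ∅ A⊆∅ A∈)) empty∉
  ... | ()

  full∈ : W full ≡ true
  full∈ with ultra ∅
  ... | inj₁ ∅∈ = ⊥-elim (member-⊈∅ ∅∈ (λ _ h → h))
  ... | inj₂ full∈′ = full∈′

  ⋂<-∈ : (F : ℕ → Subset S) → (∀ k → W (F k) ≡ true) → ∀ m → W (⋂< F m) ≡ true
  ⋂<-∈ F F∈ zero = full∈
  ⋂<-∈ F F∈ (suc m) = inter _ _ (⋂<-∈ F F∈ m) (F∈ m)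

  base-choice : ∀ {B} → IsFilterBase W B → ∀ A → ∃[ C ] (B C × (W A ≡ true → C ⊆ A))
  base-choice (_ , below) A with W A in A∈
  ... | true = let (C , BC , C⊆A) = below A A∈ in C , BC , λ _ → C⊆A
  ... | false = let (C , BC , _) = below full full∈ in C , BC , λ ()

  inhabited : ExcludedMiddle 0ℓ → ∀ {A} → W A ≡ true → ∃[ s ] (A s ≡ true)
  inhabited em {A} A∈ with em {∃[ s ] (A s ≡ true)}
  ... | yes p = p
  ... | no ¬p = ⊥-elim (member-⊈∅ A∈ (λ s h → ⊥-elim (¬p (s , h))))

_⊗_ : Subset ℕ → (ℕ → Subset ℕ) → Subset (ℕ × ℕ)
(X ⊗ Y) (n , j) = X n ∧ Y n j

⊗-∩ : ∀ X Y X′ Y′ p → ((X ⊗ Y) ∩ (X′ ⊗ Y′)) p ≡ ((X ∩ X′) ⊗ (λ n → Y n ∩ Y′ n)) p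
⊗-∩ X Y X′ Y′ (n , j) = interchange (X n) (Y n j) (X′ n) (Y′ n j)

Rectangle : (Subset ℕ → Set) → (ℕ → Subset ℕ → Set) → Subset (ℕ × ℕ) → Set
Rectangle B Bs D = Σ (Subset ℕ) λ X → Σ (ℕ → Subset ℕ) λ Y →
  B X × (∀ n → Bs n (Y n)) × (∀ p → D p ≡ (X ⊗ Y) p)

rectangles-closed : ∀ {B Bs} → ClosedUnderFiniteIntersections B →
  (∀ n → ClosedUnderFiniteIntersections (Bs n)) → ClosedUnderFiniteIntersections (Rectangle B Bs)
rectangles-closed Bfi Bsfi D E (X , Y , BX , BY , D≡) (X′ , Y′ , BX′ , BY′ , E≡) =
  X ∩ X′ , (λ n → Y n ∩ Y′ n) , Bfi X X′ BX BX′ , (λ n → Bsfi n _ _ (BY n) (BY′ n)) ,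
  λ p → trans (cong₂ _∧_ (D≡ p) (E≡ p)) (⊗-∩ X Y X′ Y′ p)

module Limit (U : Family ℕ) (Us : ℕ → Family ℕ)
             (uU : IsUltrafilter U) (uUs : ∀ n → IsUltrafilter (Us n)) where
  module U = IsUltrafilter uU
  module Us n = IsUltrafilter (uUs n)

  V : Family (ℕ × ℕ)
  V = limU U Us

  row : Subset (ℕ × ℕ) → ℕ → Subset ℕ
  row A n j = A (n , j)

  -- V is an ultrafilter: each axiom holds row by row, then in U.
  limU-isUltrafilter : IsUltrafilter V
  limU-isUltrafilter = record
    { empty∉ = empty∉ ; upward = upward ; inter = inter ; ultra = ultra }
    where
    empty∉ : V ∅ ≡ false
    empty∉ with V ∅ in ∅∈
    ... | false = refl
    ... | true = ⊥-elim (UltrafilterFacts.member-⊈∅ uU ∅∈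
                   (λ n ∅ₙ∈ → ⊥-elim (UltrafilterFacts.member-⊈∅ (uUs n) ∅ₙ∈ (λ _ h → h))))
    upward : ∀ A B → A ⊆ B → V A ≡ true → V B ≡ true
    upward A B A⊆B = U.upward _ _ (λ n → Us.upward n _ _ (λ j → A⊆B (n , j)))
    inter : ∀ A B → V A ≡ true → V B ≡ true → V (A ∩ B) ≡ true
    inter A B A∈ B∈ = U.upward _ _
      (λ n h → Us.inter n _ _ (∧-conicalˡ _ _ h) (∧-conicalʳ _ _ h)) (U.inter _ _ A∈ B∈)
    complement-row : ∀ A n → (ᶜ (λ m → Us m (row A m))) n ≡ true → Us n (row (ᶜ A) n) ≡ true
    complement-row A n ᶜrow∉ with Us.ultra n (row A n)
    ... | inj₂ ᶜrow∈ = ᶜrow∈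
    ... | inj₁ row∈ with trans (sym ᶜrow∉) (cong not row∈)
    ...   | ()
    ultra : ∀ A → (V A ≡ true) ⊎ (V (ᶜ A) ≡ true)
    ultra A with U.ultra (λ n → Us n (row A n))
    ... | inj₁ A∈ = inj₁ A∈
    ... | inj₂ ᶜA∈ = inj₂ (U.upward _ _ (complement-row A) ᶜA∈)

  ⊗-∈ : ∀ {X Y} → U X ≡ true → (∀ n → X n ≡ true → Us n (Y n) ≡ true) → V (X ⊗ Y) ≡ true
  ⊗-∈ X∈ Y∈ = U.upward _ _
    (λ n Xn → Us.upward n _ _ (λ j → ∧-intro Xn) (Y∈ n Xn)) X∈

  rectangles-base : ∀ {B Bs} → IsFilterBase U B → (∀ n → IsFilterBase (Us n) (Bs n)) →
                    IsFilterBase V (Rectangle B Bs)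
  rectangles-base {B} {Bs} (B⊆U , U-below) Bs-base = rectangle∈ , below
    where
    open IsUltrafilter limU-isUltrafilter using (upward)
    rectangle∈ : ∀ D → Rectangle B Bs D → V D ≡ true
    rectangle∈ D (X , Y , BX , BY , D≡) =
      upward (X ⊗ Y) D (λ p → trans (D≡ p))
        (⊗-∈ (B⊆U X BX) (λ n _ → proj₁ (Bs-base n) (Y n) (BY n)))
    -- The base is chosen below the set of good rows, each row below row A n.
    below : ∀ A → V A ≡ true → ∃[ C ] (Rectangle B Bs C × C ⊆ A)
    below A A∈ =
      X ⊗ Y , (X , Y , BX , (λ n → proj₁ (proj₂ (row-choice n))) , λ _ → refl) , X⊗Y⊆A
      where
      good : ∃[ X ] (B X × X ⊆ (λ n → Us n (row A n)))
      good = U-below (λ n → Us n (row A n)) A∈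
      X : Subset ℕ
      X = proj₁ good
      BX : B X
      BX = proj₁ (proj₂ good)
      row-choice : ∀ n → ∃[ Z ] (Bs n Z × (Us n (row A n) ≡ true → Z ⊆ row A n))
      row-choice n = UltrafilterFacts.base-choice (uUs n) (Bs-base n) (row A n)
      Y : ℕ → Subset ℕ
      Y n = proj₁ (row-choice n)
      X⊗Y⊆A : (X ⊗ Y) ⊆ A
      X⊗Y⊆A (n , j) h =
        proj₂ (proj₂ (row-choice n)) (proj₂ (proj₂ good) n (∧-conicalˡ _ _ h)) j (∧-conicalʳ _ _ h)

  module Convergence
    (em : ExcludedMiddle 0ℓ)
    {B : Subset ℕ → Set} (BFI : ClosedUnderFiniteIntersections B) (Bg : BasicallyGeneratedBy U B)
    {Bs : ℕ → Subset ℕ → Set} (Bsg : ∀ n → BasicallyGeneratedBy (Us n) (Bs n))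
    (A : ℕ → Subset (ℕ × ℕ)) (L : Subset (ℕ × ℕ))
    (A-rect : ∀ m → Rectangle B Bs (A m)) (L-rect : Rectangle B Bs L) (A→L : Converges A L)
    where

    Xm : ℕ → Subset ℕ
    Xm m = proj₁ (A-rect m)
    Ym : ℕ → ℕ → Subset ℕ
    Ym m = proj₁ (proj₂ (A-rect m))
    BXm : ∀ m → B (Xm m)
    BXm m = proj₁ (proj₂ (proj₂ (A-rect m)))
    BYm : ∀ m n → Bs n (Ym m n)
    BYm m = proj₁ (proj₂ (proj₂ (proj₂ (A-rect m))))
    A≡ : ∀ m p → A m p ≡ (Xm m ⊗ Ym m) p
    A≡ m = proj₂ (proj₂ (proj₂ (proj₂ (A-rect m))))
    X : Subset ℕ
    X = proj₁ L-rect
    Y : ℕ → Subset ℕ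
    Y = proj₁ (proj₂ L-rect)
    BX : B X
    BX = proj₁ (proj₂ (proj₂ L-rect))
    BY : ∀ n → Bs n (Y n)
    BY = proj₁ (proj₂ (proj₂ (proj₂ L-rect)))
    L≡ : ∀ p → L p ≡ (X ⊗ Y) p
    L≡ = proj₂ (proj₂ (proj₂ (proj₂ L-rect)))

    Bs⊆Us : ∀ n Z → Bs n Z → Us n Z ≡ true
    Bs⊆Us n = proj₁ (proj₁ (Bsg n))

    agree-at : ∀ m n j → A m (n , j) ≡ L (n , j) → Xm m n ∧ Ym m n j ≡ X n ∧ Y n j
    agree-at m n j agree = begin
      Xm m n ∧ Ym m n j  ≡⟨ sym (A≡ m (n , j)) ⟩
      A m (n , j)        ≡⟨ agree ⟩
      L (n , j)          ≡⟨ L≡ (n , j) ⟩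
      X n ∧ Y n j        ∎
      where open ≡-Reasoning

    -- For n ∈ X, row n of L is nonempty, so eventually n ∈ Xm m.
    base-eventually : ∀ n → X n ≡ true → Eventually (λ m → Xm m n ≡ true)
    base-eventually n Xn =
      let (j , Ynj) = UltrafilterFacts.inhabited (uUs n) em (Bs⊆Us n (Y n) (BY n))
          (N , agree) = A→L (n , j)
      in N , λ m N≤m → ∧-conicalˡ _ _ (trans (agree-at m n j (agree m N≤m)) (∧-intro Xn Ynj))

    bases-converge : Converges (λ m → Xm m ∩ X) X
    bases-converge n with X n in Xn
    ... | false = 0 , λ m _ → ∧-zeroʳ (Xm m n)
    ... | true  = let (N , ev) = base-eventually n Xn in
                  N , λ m N≤m → trans (∧-identityʳ (Xm m n)) (ev m N≤m)

    rows-converge : ∀ n → X n ≡ true → Converges (λ m → Ym m n) (Y n)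
    rows-converge n Xn j =
      let (N , ev) = eventually-× (base-eventually n Xn) (A→L (n , j)) in
      N , λ m N≤m → let (Xmn , agree) = ev m N≤m in begin
        Ym m n j            ≡⟨ sym (true∧ _ Xmn) ⟩
        Xm m n ∧ Ym m n j   ≡⟨ agree-at m n j agree ⟩
        X n ∧ Y n j         ≡⟨ true∧ _ Xn ⟩
        Y n j               ∎
      where open ≡-Reasoning

    first-extraction : ∃[ φ ] (StrictlyIncreasing φ × IntersectionInW U (λ k → Xm (φ k) ∩ X))
    first-extraction = proj₂ Bg (λ m → Xm m ∩ X) X (λ m → BFI _ _ (BXm m) BX) BX bases-converge

    φ₀ : ℕ → ℕ
    φ₀ = proj₁ first-extraction
    C₀ : Subset ℕ
    C₀ = proj₁ (proj₂ (proj₂ first-extraction))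
    C₀∈ : U C₀ ≡ true
    C₀∈ = proj₁ (proj₂ (proj₂ (proj₂ first-extraction)))
    C₀⊆ : ∀ k → C₀ ⊆ (Xm (φ₀ k) ∩ X)
    C₀⊆ = proj₂ (proj₂ (proj₂ (proj₂ first-extraction)))

    RowBound : ℕ → (ℕ → ℕ) → Set
    RowBound n τ = Σ (Subset ℕ) λ Cₙ →
      (X n ≡ true → Us n Cₙ ≡ true × (∀ i → Cₙ ⊆ Ym (τ i) n))

    refine : ∀ n ψ → StrictlyIncreasing ψ → ∃[ ρ ] (StrictlyIncreasing ρ × RowBound n (ψ ∘ ρ))
    refine n ψ ψ-inc with X n in Xn
    ... | false = id , (λ k → n<1+n k) , full , λ ()
    ... | true  =
      let (ρ , ρ-inc , Cₙ , Cₙ∈ , Cₙ⊆) =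
            proj₂ (Bsg n) (λ k → Ym (ψ k) n) (Y n) (λ k → BYm (ψ k) n) (BY n)
              (converges-subsequence ψ-inc (rows-converge n Xn))
      in ρ , ρ-inc , Cₙ , λ _ → Cₙ∈ , Cₙ⊆

    open Diagonalisation RowBound refine φ₀ (proj₁ (proj₂ first-extraction))

    C : ℕ → Subset ℕ
    C n = proj₁ (stage-has-Q n)

    -- δ is a subsequence of φ₀, and from index n on of the n-th refined stage.
    C₀-below : ∀ k → C₀ ⊆ (Xm (δ k) ∩ X)
    C₀-below k with δ-occurs {0} {k} z≤n
    ... | i , δk≡ = subst (λ m → C₀ ⊆ (Xm m ∩ X)) (sym δk≡) (C₀⊆ i)

    C-below : ∀ n k → X n ≡ true → n ≤ k → C n ⊆ Ym (δ k) n
    C-below n k Xn n≤k with δ-occurs (s≤s n≤k)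
    ... | i , δk≡ = subst (λ m → C n ⊆ Ym m n) (sym δk≡) (proj₂ (proj₂ (stage-has-Q n) Xn) i)

    -- Row n of the witness: Cₙ handles k ≥ n, the finite intersection k < n.
    E-row : ℕ → Subset ℕ
    E-row n = C n ∩ ⋂< (λ k → Ym (δ k) n) n

    E : Subset (ℕ × ℕ)
    E = C₀ ⊗ E-row

    -- Each row of E over C₀ is a finite intersection of members of Uₙ.
    E∈ : V E ≡ true
    E∈ = ⊗-∈ C₀∈ λ n C₀n →
      let Xn = ∧-conicalʳ _ _ (C₀⊆ 0 n C₀n) in
      Us.inter n _ _ (proj₁ (proj₂ (stage-has-Q n) Xn))
        (UltrafilterFacts.⋂<-∈ (uUs n) _ (λ k → Bs⊆Us n _ (BYm (δ k) n)) n)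

    -- At (n , j) ∈ E: C₀ gives n ∈ Xm (δ k), and j ∈ Ym (δ k) n comes from the
    -- finite intersection if k < n and from Cₙ if n ≤ k.
    E⊆ : ∀ k → E ⊆ A (δ k)
    E⊆ k (n , j) h = trans (A≡ (δ k) (n , j)) (∧-intro (∧-conicalˡ _ _ base) in-row)
      where
      base : (Xm (δ k) ∩ X) n ≡ true
      base = C₀-below k n (∧-conicalˡ (C₀ n) (E-row n j) h)
      E-row∋j : E-row n j ≡ true
      E-row∋j = ∧-conicalʳ (C₀ n) (E-row n j) h
      in-row : Ym (δ k) n j ≡ true
      in-row with <-≤-connex k n
      ... | inj₁ k<n = ⋂<-⊆ _ k<n j (∧-conicalʳ _ _ E-row∋j)
      ... | inj₂ n≤k = C-below n k (∧-conicalʳ _ _ base) n≤k j (∧-conicalˡ _ _ E-row∋j)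

    convergent-subsequence : ∃[ φ ] (StrictlyIncreasing φ × IntersectionInW V (A ∘ φ))
    convergent-subsequence = δ , δ-increasing , E , E∈ , E⊆

  limU-basicallyGeneratedFI : ExcludedMiddle 0ℓ → BasicallyGeneratedFI U →
                              (∀ n → BasicallyGeneratedFI (Us n)) → BasicallyGeneratedFI V
  limU-basicallyGeneratedFI em (B , BFI , Bg) Us-bg =
    Rectangle B Bs ,
    rectangles-closed BFI (λ n → proj₁ (proj₂ (Us-bg n))) ,
    rectangles-base (proj₁ Bg) (λ n → proj₁ (Bsg n)) ,
    λ A L A-rect L-rect A→L →
      Convergence.convergent-subsequence em BFI Bg Bsg A L A-rect L-rect A→L
    where
    Bs : ℕ → Subset ℕ → Set
    Bs n = proj₁ (Us-bg n)
    Bsg : ∀ n → BasicallyGeneratedBy (Us n) (Bs n)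
    Bsg n = proj₂ (proj₂ (Us-bg n))

theorem16 : ExcludedMiddle 0ℓ →
    ((U : Family ℕ) (Us : ℕ → Family ℕ) →
    IsUltrafilter U → (∀ n → IsUltrafilter (Us n)) →
    BasicallyGeneratedFI U → (∀ n → BasicallyGeneratedFI (Us n)) →
    IsUltrafilter (limU U Us) × BasicallyGeneratedFI (limU U Us)) ×
    ((U V : Family ℕ) →
    IsUltrafilter U → IsUltrafilter V →
    BasicallyGeneratedFI U → BasicallyGeneratedFI V →
    IsUltrafilter (U · V) × BasicallyGeneratedFI (U · V))
theorem16 em = limit , λ U V uU uV bU bV → limit U (λ _ → V) uU (λ _ → uV) bU (λ _ → bV)
  where
  limit : (U : Family ℕ) (Us : ℕ → Family ℕ) →
    IsUltrafilter U → (∀ n → IsUltrafilter (Us n)) →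
    BasicallyGeneratedFI U → (∀ n → BasicallyGeneratedFI (Us n)) →
    IsUltrafilter (limU U Us) × BasicallyGeneratedFI (limU U Us)
  limit U Us uU uUs bU bUs =
    Limit.limU-isUltrafilter U Us uU uUs , Limit.limU-basicallyGeneratedFI U Us uU uUs em bU bUs
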